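{- Let $q=p^n$ with $p$ an odd prime, let $\alpha,\beta\in GF(q^2)$ with $\alpha\neq0$ and $4N(\alpha)+(\overline{\beta}-\beta)^2$ a non-square in $GF(q)$, let $\lambda\in\{1,w\}$ and $P_\lambda=[0,\lambda\epsilon,1]$. For $z\in GF(q^2)$ let $Q_z=[z,\,T(\alpha z^2)-\lambda\epsilon,\,1]$, and let $T_\lambda=\{z\in GF(q^2): 2\lambda\epsilon+\alpha z^2-\overline{\alpha}\,\overline{z}^2+(\beta-\overline{\beta})N(z)=0\}$ (so that $\tau_{P_\lambda}(U_{\alpha,\beta})=\{Q_z: z\in T_\lambda\}$, and $z\in T_\lambda$ iff $-z\in T_\lambda$). Let $x\in T_\lambda$ and let $l_{x,-x}$ be the line through $Q_x$ and $Q_{ -x}$. If $Q_y\in l_{x,-x}$ for some $y\in T_\lambda$, then $Q_{ -y}\in l_{x,-x}$.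
   Context: $GF(q^2)=\{a+\epsilon b: a,b\in GF(q)\}$ with $\epsilon^2=w\in GF(q)$, $\epsilon\notin GF(q)$. For $x\in GF(q^2)$ write $\overline{x}=x^q$, $T(x)=x+\overline{x}$, $N(x)=x\overline{x}$. Points of $PG(2,q^2)$ are written $[a,b,c]$ (homogeneous coordinates). $P_\infty=[0,1,0]$. The orthogonal-Buekenhout-Metz unital is $U_{\alpha,\beta}=\{[x,\alpha x^2+\beta N(x)+r,1]: x\in GF(q^2), r\in GF(q)\}\cup\{P_\infty\}$. For a point $P\notin U_{\alpha,\beta}$, $\tau_P(U_{\alpha,\beta})$ denotes the set of $q+1$ points of contact with $U_{\alpha,\beta}$ of the tangent lines (lines meeting $U_{\alpha,\beta}$ in exactly one point) through $P$. -}

module Defs where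

open import Level using (0ℓ)
open import Data.Nat as ℕ using (ℕ; zero; suc)
open import Data.Nat.Primality using (Prime)
open import Data.Product using (_×_; _,_; ∃; Σ)
open import Data.Sum using (_⊎_)
open import Data.List using (List; length)
open import Data.List.Membership.Propositional using (_∈_)
open import Data.List.Relation.Unary.Unique.Propositional using (Unique)
open import Relation.Binary.PropositionalEquality using (_≡_; _≢_)
open import Relation.Binary.Definitions using (DecidableEquality)
open import Relation.Nullary using (¬_)
open import Algebra.Structures using (IsCommutativeRing)

record GFq : Set₁ where
  field
    K    : Set
    _+_  : K → K → K
    _*_  : K → K → K
    -_   : K → K
    0#   : K
    1#   : K
    isCommutativeRing : IsCommutativeRing _≡_ _+_ _*_ -_ 0# 1#
    0≢1  : 0# ≢ 1#
    inv  : ∀ x → x ≢ 0# → ∃ λ y → x * y ≡ 1#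
    _≟_  : DecidableEquality K
    p    : ℕ
    n    : ℕ
    p-prime : Prime p
    p-odd   : ¬ (p ≡ 2)
    n≥1     : 1 ℕ.≤ n
    elements : List K
    elements-unique   : Unique elements
    elements-complete : ∀ x → x ∈ elements
    elements-size     : length elements ≡ p ℕ.^ n

  q : ℕ
  q = p ℕ.^ n

  IsSquare : K → Set
  IsSquare a = ∃ λ s → s * s ≡ a

-- GF(q^2) = { a + ε b : a, b ∈ GF(q) } with ε² = w, w a non-square of GF(q).
module GFq² (F : GFq) (w : GFq.K F) (w-nonsquare : ¬ GFq.IsSquare F w) where
  open GFq F renaming (_+_ to _+ₖ_; _*_ to _*ₖ_; -_ to -ₖ_)

  -- (a , b) represents a + ε b
  E : Set
  E = K × K

  embed : K → E
  embed a = (a , 0#)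

  0E 1E ε : E
  0E = embed 0#
  1E = embed 1#
  ε  = (0# , 1#)

  _+E_ : E → E → E
  (a , b) +E (c , d) = (a +ₖ c , b +ₖ d)

  -E_ : E → E
  -E (a , b) = (-ₖ a , -ₖ b)

  _-E_ : E → E → E
  x -E y = x +E (-E y)

  _*E_ : E → E → E
  (a , b) *E (c , d) = ((a *ₖ c) +ₖ (w *ₖ (b *ₖ d)) , (a *ₖ d) +ₖ (b *ₖ c))

  _^E_ : E → ℕ → E
  x ^E zero  = 1E
  x ^E suc m = x *E (x ^E m)

  conj : E → E
  conj x = x ^E q

  T : E → E
  T x = x +E conj x

  N : E → E
  N x = x *E conj x

  two : E
  two = 1E +E 1E

  four : E
  four = two +E two

  NonSquareInGFq : E → Set
  NonSquareInGFq x = (∃ λ a → x ≡ embed a) × ¬ (∃ λ s → embed s *E embed s ≡ x)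

  -- points and lines of PG(2,q^2) in homogeneous coordinates
  Triple : Set
  Triple = E × E × E

  NonZero : Triple → Set
  NonZero (a , b , c) = ¬ (a ≡ 0E × b ≡ 0E × c ≡ 0E)

  _∈L_ : Triple → Triple → Set
  (a , b , c) ∈L (u , v , t) = ((u *E a) +E (v *E b)) +E (t *E c) ≡ 0E

  module Setting (α β λ' : E) where
    P-λ : Triple
    P-λ = (0E , λ' *E ε , 1E)

    Q : E → Triple
    Q z = (z , T (α *E (z *E z)) -E (λ' *E ε) , 1E)

    T-λ : E → Set
    T-λ z = (((two *E (λ' *E ε)) +E (α *E (z *E z)))
               -E (conj α *E (conj z *E conj z)))
               +E ((β -E conj β) *E N z) ≡ 0E

module Submission where

-- Q z and Q (-z) differ only in their first coordinate, because the second one depends on z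
-- through z² alone. So if a line [u,v,t] contains Q x and Q (-x), then u x = u (-x) = -(u x),
-- and since GF(q²) is a field of odd characteristic and x ≠ 0 (0 ∉ T_λ), u = 0. A line with
-- u = 0 contains Q y exactly when it contains Q (-y).

open import Defs
open import Level using (0ℓ)
open import Algebra.Bundles using (CommutativeRing)
open import Algebra.Structures using (IsCommutativeRing)
import Algebra.Consequences.Propositional as Consequences
open import Data.Nat as ℕ using (zero; suc)
open import Data.Nat.Divisibility using (_∣_; divides)
open import Data.Nat.Primality using (Prime; euclidsLemma; prime⇒irreducible; prime⇒nonZero; prime[2])
open import Data.Nat.Properties using (suc-injective; m^n>0)
open import Data.Product using (_×_; _,_; proj₁; proj₂)
open import Data.Sum using (_⊎_; inj₁; inj₂)
open import Data.Empty using (⊥-elim)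
open import Data.List using (List; []; _∷_; length; filter)
open import Data.List.Membership.Propositional using (_∈_)
open import Data.List.Membership.Propositional.Properties using (∈-filter⁺; ∈-filter⁻)
open import Data.List.Relation.Unary.Any using (here; there)
open import Data.List.Relation.Unary.All as All using (All; []; _∷_)
open import Data.List.Relation.Unary.AllPairs using ([]; _∷_)
open import Data.List.Relation.Unary.Unique.Propositional using (Unique)
open import Data.List.Relation.Unary.Unique.Propositional.Properties using (filter⁺)
open import Relation.Binary.Definitions using (DecidableEquality)
open import Relation.Binary.PropositionalEquality
open import Relation.Nullary using (¬_; yes; no; ¬?)

module FixedPointFreeInvolution {A : Set} (_≟_ : DecidableEquality A) (σ : A → A)
  (σ-involutive : ∀ x → σ (σ x) ≡ x) (σ-fixedPointFree : ∀ x → σ x ≢ x) where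

  remove : A → List A → List A
  remove b = filter (λ z → ¬? (z ≟ b))

  remove-∉ : ∀ b xs → All (_≢ b) xs → remove b xs ≡ xs
  remove-∉ b [] _ = refl
  remove-∉ b (c ∷ cs) (c≢b ∷ cs≢b) with c ≟ b
  ... | yes c≡b = ⊥-elim (c≢b c≡b)
  ... | no _    = cong (c ∷_) (remove-∉ b cs cs≢b)

  length-remove : ∀ b xs → b ∈ xs → Unique xs → length xs ≡ suc (length (remove b xs))
  length-remove b (c ∷ cs) b∈ (c∉cs ∷ cs-unique) with c ≟ b
  ... | yes refl = cong suc (cong length (sym (remove-∉ b cs (All.map (λ c≢z z≡c → c≢z (sym z≡c)) c∉cs))))
  ... | no c≢b with b∈
  ...   | here b≡c   = ⊥-elim (c≢b (sym b≡c))
  ...   | there b∈cs = cong suc (length-remove b cs b∈cs cs-unique)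

  -- Remove the pair a, σ a and recurse; the explicit length m makes the recursion structural.
  even-length : ∀ m xs → length xs ≡ m → Unique xs → (∀ {z} → z ∈ xs → σ z ∈ xs) → 2 ∣ m
  even-length m [] len≡m _ _ = divides 0 (sym len≡m)
  even-length m (a ∷ xs) len≡m (a∉xs ∷ xs-unique) closed =
    even-suc-suc m (trans (sym len≡m) (cong suc (length-remove (σ a) xs σa∈xs xs-unique)))
    where
    σa∈xs : σ a ∈ xs
    σa∈xs with closed (here refl)
    ... | here σa≡a   = ⊥-elim (σ-fixedPointFree a σa≡a)
    ... | there σa∈xs = σa∈xs

    ys : List A
    ys = remove (σ a) xs

    ys-closed : ∀ {z} → z ∈ ys → σ z ∈ ys
    ys-closed {z} z∈ys with ∈-filter⁻ (λ z → ¬? (z ≟ σ a)) z∈ys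
    ... | z∈xs , z≢σa with closed (there z∈xs)
    ...   | here σz≡a   = ⊥-elim (z≢σa (trans (sym (σ-involutive z)) (cong σ σz≡a)))
    ...   | there σz∈xs = ∈-filter⁺ (λ z → ¬? (z ≟ σ a)) σz∈xs
              (λ σz≡σa → All.lookup a∉xs z∈xs
                (sym (trans (sym (σ-involutive z)) (trans (cong σ σz≡σa) (σ-involutive a)))))

    even-suc-suc : ∀ m → m ≡ suc (suc (length ys)) → 2 ∣ m
    even-suc-suc (suc (suc m)) m≡ with even-length m ys (sym (suc-injective (suc-injective m≡)))
                                          (filter⁺ (λ z → ¬? (z ≟ σ a)) xs-unique) ys-closed
    ... | divides k m≡k*2 = divides (suc k) (cong (λ z → suc (suc z)) m≡k*2)

odd-prime-power : ∀ {p} → Prime p → p ≢ 2 → ∀ n → ¬ 2 ∣ p ℕ.^ n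
odd-prime-power p-prime p≢2 zero (divides (suc zero) ())
odd-prime-power p-prime p≢2 zero (divides (suc (suc _)) ())
odd-prime-power {p} p-prime p≢2 (suc n) 2∣pⁿ⁺¹ with euclidsLemma p (p ℕ.^ n) prime[2] 2∣pⁿ⁺¹
... | inj₂ 2∣pⁿ = odd-prime-power p-prime p≢2 n 2∣pⁿ
... | inj₁ 2∣p with prime⇒irreducible p-prime 2∣p
...   | inj₁ ()
...   | inj₂ 2≡p = p≢2 (sym 2≡p)

module IntegralDomain {A : Set} {_+_ _*_ : A → A → A} { -_ : A → A} {0# 1# : A}
  (isCommutativeRing : IsCommutativeRing _≡_ _+_ _*_ -_ 0# 1#)
  (noZeroDivisors : ∀ {a b} → a * b ≡ 0# → b ≢ 0# → a ≡ 0#) where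

  commutativeRing : CommutativeRing 0ℓ 0ℓ
  commutativeRing = record { isCommutativeRing = isCommutativeRing }

  open CommutativeRing commutativeRing using (*-comm; distribʳ; *-identityˡ; -‿inverseʳ; _-_)
  open import Algebra.Properties.Ring (CommutativeRing.ring commutativeRing)
    using (x[y-z]≈xy-xz; x≈y⇒x∙y⁻¹≈ε; x∙y⁻¹≈ε⇒x≈y; -‿distribʳ-*)
  open ≡-Reasoning

  *-≢0 : ∀ {a b} → a ≢ 0# → b ≢ 0# → a * b ≢ 0#
  *-≢0 a≢0 b≢0 ab≡0 = a≢0 (noZeroDivisors ab≡0 b≢0)

  *-cancelˡ-≢0 : ∀ {a x y} → a ≢ 0# → a * x ≡ a * y → x ≡ y
  *-cancelˡ-≢0 {a} {x} {y} a≢0 ax≡ay = x∙y⁻¹≈ε⇒x≈y x y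
    (noZeroDivisors (trans (*-comm (x - y) a) (trans (x[y-z]≈xy-xz a x y) (x≈y⇒x∙y⁻¹≈ε ax≡ay))) a≢0)

  module _ (1+1≢0 : 1# + 1# ≢ 0#) where

    x≡-x⇒x≡0 : ∀ {x} → x ≡ - x → x ≡ 0#
    x≡-x⇒x≡0 {x} x≡-x = noZeroDivisors (begin
      x * (1# + 1#)       ≡⟨ *-comm x (1# + 1#) ⟩
      (1# + 1#) * x       ≡⟨ distribʳ x 1# 1# ⟩
      (1# * x) + (1# * x) ≡⟨ cong₂ _+_ (*-identityˡ x) (*-identityˡ x) ⟩
      x + x               ≡⟨ cong (x +_) x≡-x ⟩
      x + (- x)           ≡⟨ -‿inverseʳ x ⟩
      0#                  ∎) 1+1≢0

    u*x≡u*-x⇒u≡0 : ∀ {u x} → x ≢ 0# → u * x ≡ u * (- x) → u ≡ 0#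
    u*x≡u*-x⇒u≡0 {u} {x} x≢0 ux≡u-x =
      noZeroDivisors (x≡-x⇒x≡0 (trans ux≡u-x (sym (-‿distribʳ-* u x)))) x≢0

module GFqProperties (F : GFq) where
  open GFq F

  private
    ring : CommutativeRing 0ℓ 0ℓ
    ring = record { isCommutativeRing = isCommutativeRing }
  open CommutativeRing ring using (+-assoc; +-comm; +-identityˡ; +-identityʳ; *-assoc; *-identityʳ; zeroˡ)
  open import Algebra.Properties.Ring (CommutativeRing.ring ring) using (+-cancelʳ)
  open ≡-Reasoning

  noZeroDivisors : ∀ {a b} → a * b ≡ 0# → b ≢ 0# → a ≡ 0#
  noZeroDivisors {a} {b} ab≡0 b≢0 with inv b b≢0
  ... | b⁻¹ , bb⁻¹≡1 = begin
    a              ≡⟨ sym (*-identityʳ a) ⟩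
    a * 1#         ≡⟨ cong (a *_) (sym bb⁻¹≡1) ⟩
    a * (b * b⁻¹)  ≡⟨ sym (*-assoc a b b⁻¹) ⟩
    (a * b) * b⁻¹  ≡⟨ cong (_* b⁻¹) ab≡0 ⟩
    0# * b⁻¹       ≡⟨ zeroˡ b⁻¹ ⟩
    0#             ∎

  open IntegralDomain isCommutativeRing noZeroDivisors public

  -- If 1 + 1 = 0 then x ↦ x + 1 is a fixed-point-free involution, so q would be even.
  1+1≢0 : 1# + 1# ≢ 0#
  1+1≢0 1+1≡0 = odd-prime-power p-prime p-odd n
    (subst (2 ∣_) elements-size
      (even-length _ elements refl elements-unique (λ {z} _ → elements-complete (z + 1#))))
    where
    +1-involutive : ∀ x → (x + 1#) + 1# ≡ x
    +1-involutive x = trans (+-assoc x 1# 1#) (trans (cong (x +_) 1+1≡0) (+-identityʳ x))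
    +1-fixedPointFree : ∀ x → x + 1# ≢ x
    +1-fixedPointFree x x+1≡x = 0≢1 (+-cancelʳ x 0# 1# (trans (+-identityˡ x) (trans (sym x+1≡x) (+-comm x 1#))))
    open FixedPointFreeInvolution _≟_ (_+ 1#) +1-involutive +1-fixedPointFree

module GFq²Properties (F : GFq) (w : GFq.K F) (w-nonsquare : ¬ GFq.IsSquare F w) where
  open GFq F using (0#; 1#; 0≢1; _≟_; inv; p; n; p-prime)
  open GFq² F w w-nonsquare
  open GFqProperties F
  open CommutativeRing commutativeRing using (_+_; _*_; +-assoc; +-comm; +-identityˡ; +-identityʳ; -‿inverseˡ;
    *-comm; *-identityˡ; *-identityʳ; zeroˡ; zeroʳ; commutativeSemiring)
  open import Algebra.Solver.Ring.NaturalCoefficients.Default commutativeSemiring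
  open ≡-Reasoning

  x*x≡0⇒x≡0 : ∀ {x} → x * x ≡ 0# → x ≡ 0#
  x*x≡0⇒x≡0 {x} xx≡0 with x ≟ 0#
  ... | yes x≡0 = x≡0
  ... | no x≢0  = noZeroDivisors xx≡0 x≢0

  c²≡wd²⇒c≡d≡0 : ∀ {c d} → c * c ≡ w * (d * d) → c ≡ 0# × d ≡ 0#
  c²≡wd²⇒c≡d≡0 {c} {d} c²≡wd² with d ≟ 0#
  ... | yes refl = x*x≡0⇒x≡0 (trans c²≡wd² (trans (cong (w *_) (zeroˡ 0#)) (zeroʳ w))) , refl
  ... | no d≢0 with inv d d≢0
  ...   | d⁻¹ , dd⁻¹≡1 = ⊥-elim (w-nonsquare (c * d⁻¹ , (begin
    (c * d⁻¹) * (c * d⁻¹)    ≡⟨ solve 2 (λ c e → (c :* e) :* (c :* e) := (c :* c) :* (e :* e)) refl c d⁻¹ ⟩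
    (c * c) * (d⁻¹ * d⁻¹)    ≡⟨ cong (_* (d⁻¹ * d⁻¹)) c²≡wd² ⟩
    (w * (d * d)) * (d⁻¹ * d⁻¹) ≡⟨ solve 3 (λ w d e → (w :* (d :* d)) :* (e :* e) := w :* ((d :* e) :* (d :* e))) refl w d d⁻¹ ⟩
    w * ((d * d⁻¹) * (d * d⁻¹)) ≡⟨ cong (λ e → w * (e * e)) dd⁻¹≡1 ⟩
    w * (1# * 1#)            ≡⟨ trans (cong (w *_) (*-identityˡ 1#)) (*-identityʳ w) ⟩
    w                        ∎)))

  +E-comm : ∀ x y → x +E y ≡ y +E x
  +E-comm (a , b) (c , d) = cong₂ _,_ (+-comm a c) (+-comm b d)

  *E-comm : ∀ x y → x *E y ≡ y *E x
  *E-comm (a , b) (c , d) = cong₂ _,_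
    (cong₂ _+_ (*-comm a c) (cong (w *_) (*-comm b d)))
    (solve 4 (λ a b c d → a :* d :+ b :* c := c :* b :+ d :* a) refl a b c d)

  *E-assoc : ∀ x y z → (x *E y) *E z ≡ x *E (y *E z)
  *E-assoc (a , b) (c , d) (e , f) = cong₂ _,_
    (solve 7 (λ a b c d e f w → (a :* c :+ w :* (b :* d)) :* e :+ w :* ((a :* d :+ b :* c) :* f)
                              := a :* (c :* e :+ w :* (d :* f)) :+ w :* (b :* (c :* f :+ d :* e))) refl a b c d e f w)
    (solve 7 (λ a b c d e f w → (a :* c :+ w :* (b :* d)) :* f :+ (a :* d :+ b :* c) :* e
                              := a :* (c :* f :+ d :* e) :+ b :* (c :* e :+ w :* (d :* f))) refl a b c d e f w)

  *E-identityˡ : ∀ x → 1E *E x ≡ x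
  *E-identityˡ (c , d) = cong₂ _,_
    (trans (cong₂ _+_ (*-identityˡ c) (trans (cong (w *_) (zeroˡ d)) (zeroʳ w))) (+-identityʳ c))
    (trans (cong₂ _+_ (*-identityˡ d) (zeroˡ c)) (+-identityʳ d))

  *E-distribˡ-+E : ∀ x y z → x *E (y +E z) ≡ (x *E y) +E (x *E z)
  *E-distribˡ-+E (a , b) (c , d) (e , f) = cong₂ _,_
    (solve 7 (λ a b c d e f w → a :* (c :+ e) :+ w :* (b :* (d :+ f))
                              := (a :* c :+ w :* (b :* d)) :+ (a :* e :+ w :* (b :* f))) refl a b c d e f w)
    (solve 6 (λ a b c d e f → a :* (d :+ f) :+ b :* (c :+ e)
                            := (a :* d :+ b :* c) :+ (a :* f :+ b :* e)) refl a b c d e f)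

  E-isCommutativeRing : IsCommutativeRing _≡_ _+E_ _*E_ -E_ 0E 1E
  E-isCommutativeRing = record
    { isRing = record
      { +-isAbelianGroup = record
        { isGroup = record
          { isMonoid = record
            { isSemigroup = record
              { isMagma = record { isEquivalence = isEquivalence ; ∙-cong = cong₂ _+E_ }
              ; assoc   = λ { (a , b) (c , d) (e , f) → cong₂ _,_ (+-assoc a c e) (+-assoc b d f) }
              }
            ; identity = Consequences.comm∧idˡ⇒id +E-comm
                           λ { (a , b) → cong₂ _,_ (+-identityˡ a) (+-identityˡ b) }
            }
          ; inverse = Consequences.comm∧invˡ⇒inv +E-comm
                        λ { (a , b) → cong₂ _,_ (-‿inverseˡ a) (-‿inverseˡ b) }
          ; ⁻¹-cong = cong (-E_)
          }
        ; comm = +E-comm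
        }
      ; *-cong     = cong₂ _*E_
      ; *-assoc    = *E-assoc
      ; *-identity = Consequences.comm∧idˡ⇒id *E-comm *E-identityˡ
      ; distrib    = *E-distribˡ-+E , Consequences.comm∧distrˡ⇒distrʳ *E-comm *E-distribˡ-+E
      }
    ; *-comm = *E-comm
    }

  E-noZeroDivisors : ∀ {x y} → x *E y ≡ 0E → y ≢ 0E → x ≡ 0E
  E-noZeroDivisors {a , b} {c , d} xy≡0 y≢0 = cong₂ _,_
    (coordinate≡0 (sym (cancel-zeros (cong proj₁ xy≡0) (cong proj₂ xy≡0)
      (solve 5 (λ a b c d w → (a :* c :+ w :* (b :* d)) :* c :+ a :* (w :* (d :* d))
                            := (a :* d :+ b :* c) :* (w :* d) :+ a :* (c :* c)) refl a b c d w))))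
    (coordinate≡0 (cancel-zeros (cong proj₁ xy≡0) (cong proj₂ xy≡0)
      (solve 5 (λ a b c d w → (a :* c :+ w :* (b :* d)) :* d :+ b :* (c :* c)
                            := (a :* d :+ b :* c) :* c :+ b :* (w :* (d :* d))) refl a b c d w)))
    where
    cancel-zeros : ∀ {X Y s t L R} → X ≡ 0# → Y ≡ 0# → X * s + L ≡ Y * t + R → L ≡ R
    cancel-zeros {s = s} {t} {L} {R} refl refl eq =
      trans (sym (trans (cong (_+ L) (zeroˡ s)) (+-identityˡ L)))
            (trans eq (trans (cong (_+ R) (zeroˡ t)) (+-identityˡ R)))
    -- a (c² - w d²) = 0 while c² - w d² ≠ 0 for (c , d) ≠ 0, as w is a non-square.
    coordinate≡0 : ∀ {a} → a * (c * c) ≡ a * (w * (d * d)) → a ≡ 0#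
    coordinate≡0 {a} eq with a ≟ 0#
    ... | yes a≡0 = a≡0
    ... | no a≢0 with c²≡wd²⇒c≡d≡0 (*-cancelˡ-≢0 a≢0 eq)
    ...   | refl , refl = ⊥-elim (y≢0 refl)

  open IntegralDomain E-isCommutativeRing E-noZeroDivisors public
    using (u*x≡u*-x⇒u≡0)
    renaming (commutativeRing to E-commutativeRing; *-≢0 to *E-≢0)
  open CommutativeRing E-commutativeRing public using ()
    renaming (zeroˡ to *E-zeroˡ; zeroʳ to *E-zeroʳ; +-identityʳ to +E-identityʳ)
  open import Algebra.Properties.Ring (CommutativeRing.ring E-commutativeRing)
    using (-‿distribˡ-*; -‿distribʳ-*; -‿involutive; -0#≈0#; +-cancelʳ)

  two≢0E : two ≢ 0E
  two≢0E two≡0 = 1+1≢0 (cong proj₁ two≡0)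

  ε≢0E : ε ≢ 0E
  ε≢0E ε≡0 = 0≢1 (sym (cong proj₂ ε≡0))

  λ≢0E : ∀ {λ'} → λ' ≡ 1E ⊎ λ' ≡ embed w → λ' ≢ 0E
  λ≢0E (inj₁ refl) 1≡0 = 0≢1 (sym (cong proj₁ 1≡0))
  λ≢0E (inj₂ refl) w≡0 = w-nonsquare (0# , trans (zeroˡ 0#) (sym (cong proj₁ w≡0)))

  conj-0E : conj 0E ≡ 0E
  conj-0E = 0E^m≡0E (m^n>0 p {{prime⇒nonZero p-prime}} n)
    where
    0E^m≡0E : ∀ {m} → 0 ℕ.< m → 0E ^E m ≡ 0E
    0E^m≡0E {suc m} _ = *E-zeroˡ (0E ^E m)

  -x*-x≡x*x : ∀ x → (-E x) *E (-E x) ≡ x *E x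
  -x*-x≡x*x x = begin
    (-E x) *E (-E x)  ≡⟨ sym (-‿distribˡ-* x (-E x)) ⟩
    -E (x *E (-E x))  ≡⟨ cong (-E_) (sym (-‿distribʳ-* x x)) ⟩
    -E (-E (x *E x))  ≡⟨ -‿involutive (x *E x) ⟩
    x *E x            ∎

  ∈L-cancel : ∀ {a a' b c u v t} → (a , b , c) ∈L (u , v , t) → (a' , b , c) ∈L (u , v , t)
            → u *E a ≡ u *E a'
  ∈L-cancel {b = b} {c} {v = v} {t} a∈l a'∈l =
    +-cancelʳ (v *E b) _ _ (+-cancelʳ (t *E c) _ _ (trans a∈l (sym a'∈l)))

  ∈L-transfer : ∀ {a a' b c u v t} → u *E a ≡ u *E a' → (a , b , c) ∈L (u , v , t)
              → (a' , b , c) ∈L (u , v , t)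
  ∈L-transfer {b = b} {c} {v = v} {t} ua≡ua' = subst (λ m → (m +E (v *E b)) +E (t *E c) ≡ 0E) ua≡ua'

  module _ (α β λ' : E) where
    open Setting α β λ'

    Q-neg : ∀ z → Q (-E z) ≡ (-E z , T (α *E (z *E z)) -E (λ' *E ε) , 1E)
    Q-neg z = cong (λ s → (-E z , T (α *E s) -E (λ' *E ε) , 1E)) (-x*-x≡x*x z)

    T-λ⇒≢0E : λ' ≡ 1E ⊎ λ' ≡ embed w → ∀ {z} → T-λ z → z ≢ 0E
    T-λ⇒≢0E λ-choice z∈T refl = *E-≢0 two≢0E (*E-≢0 (λ≢0E λ-choice) ε≢0E) (begin
      X                                                          ≡⟨ sym g[0]≡X ⟩
      g 0E                                                       ≡⟨ cong g (sym (*E-zeroˡ 0E)) ⟩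
      g (0E *E 0E)                                               ≡⟨ cong (λ c → h (c *E c) (0E *E c)) (sym conj-0E) ⟩
      h (conj 0E *E conj 0E) (0E *E conj 0E)                     ≡⟨ z∈T ⟩
      0E                                                         ∎)
      where
      X : E
      X = two *E (λ' *E ε)
      h : E → E → E
      h s s' = ((X +E (α *E (0E *E 0E))) -E (conj α *E s)) +E ((β -E conj β) *E s')
      g : E → E
      g s = ((X +E (α *E s)) -E (conj α *E s)) +E ((β -E conj β) *E s)
      g[0]≡X : g 0E ≡ X
      g[0]≡X = begin
        ((X +E (α *E 0E)) -E (conj α *E 0E)) +E ((β -E conj β) *E 0E)
          ≡⟨ cong₂ (λ a b → ((X +E a) -E b) +E ((β -E conj β) *E 0E)) (*E-zeroʳ α) (*E-zeroʳ (conj α)) ⟩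
        ((X +E 0E) -E 0E) +E ((β -E conj β) *E 0E)   ≡⟨ cong (((X +E 0E) -E 0E) +E_) (*E-zeroʳ (β -E conj β)) ⟩
        ((X +E 0E) -E 0E) +E 0E                      ≡⟨ +E-identityʳ _ ⟩
        (X +E 0E) -E 0E                              ≡⟨ cong ((X +E 0E) +E_) -0#≈0# ⟩
        (X +E 0E) +E 0E                              ≡⟨ +E-identityʳ _ ⟩
        X +E 0E                                      ≡⟨ +E-identityʳ X ⟩
        X                                            ∎

mainTheorem8 : (F : GFq) (w : GFq.K F) (w-ns : ¬ GFq.IsSquare F w)
    → let open GFq² F w w-ns in
    (α β : E) → α ≢ 0E
    → NonSquareInGFq ((four *E N α) +E ((conj β -E β) *E (conj β -E β)))
    → (λ' : E) → (λ' ≡ 1E ⊎ λ' ≡ embed w)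
    → let open Setting α β λ' in
    (x : E) → T-λ x
    → (l : Triple) → NonZero l → Q x ∈L l → Q (-E x) ∈L l
    → (y : E) → T-λ y → Q y ∈L l
    → Q (-E y) ∈L l
mainTheorem8 F w w-ns α β _ _ λ' λ-choice x x∈T (u , v , t) _ Qx∈l Q-x∈l y _ Qy∈l =
  subst (_∈L (u , v , t)) (sym (Q-neg α β λ' y)) (∈L-transfer u*y≡u*-y Qy∈l)
  where
  open GFq² F w w-ns
  open GFq²Properties F w w-ns

  u≡0E : u ≡ 0E
  u≡0E = u*x≡u*-x⇒u≡0 two≢0E (T-λ⇒≢0E α β λ' λ-choice x∈T)
    (∈L-cancel Qx∈l (subst (_∈L (u , v , t)) (Q-neg α β λ' x) Q-x∈l))

  u*y≡u*-y : u *E y ≡ u *E (-E y)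
  u*y≡u*-y = begin
    u *E y         ≡⟨ cong (_*E y) u≡0E ⟩
    0E *E y        ≡⟨ *E-zeroˡ y ⟩
    0E             ≡⟨ sym (*E-zeroˡ (-E y)) ⟩
    0E *E (-E y)   ≡⟨ cong (_*E (-E y)) (sym u≡0E) ⟩
    u *E (-E y)    ∎
    where open ≡-Reasoning
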